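{- Let $n\geq 3$ and $k\geq 2$. Suppose that edge-disjoint subgraphs $G_1,\dots,G_k$ of $K_n$ satisfy $\sum_{i=1}^k\mathrm{Mad}(G_i)=M(k,n)$. Let $X_j\subseteq V(G_j)$, $j=1,\dots,k$, be vertex sets with $2e(G_j[X_j])/|X_j|=\mathrm{Mad}(G_j)$, and assume $|X_1|\leq\dots\leq|X_k|$. Let $H_1$ be the complete graph on $X_1$, and for $j\geq 2$ let $H_j$ be the graph with $V(H_j)=X_j$ and $E(H_j)=E(K_n[X_j])\setminus\bigcup_{i<j}E(H_i)$. Then also $\sum_{j=1}^k\mathrm{Mad}(H_j)=M(k,n)$, and $\mathrm{Mad}(H_j)$ is realized on $X_j$, i.e. $\mathrm{Mad}(H_j)=2e(H_j)/|X_j|$, for every $j$.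
   Context: For a finite graph $G$, $\mathrm{Mad}(G)=\max\{2e(H)/|V(H)| : H\subseteq G,\ |V(H)|\geq 1\}$; $G[X]$ is the subgraph induced by $X$. $M(k,n)$ is the maximum of $\sum_{i=1}^k\mathrm{Mad}(G_i)$ over all partitions of $E(K_n)$ into $k$ spanning subgraphs (equivalently, since $\mathrm{Mad}$ is monotone under taking subgraphs, over all families of $k$ pairwise edge-disjoint subgraphs of $K_n$). -}

module Defs where

open import Data.Bool using (Bool; true; false; _∧_; _∨_; not; if_then_else_)
open import Data.Nat using (ℕ; zero; suc; _+_; _*_; _<ᵇ_; _≤_; _<_)
open import Data.Nat as ℕ using ()
open import Data.Fin using (Fin; toℕ; fromℕ<)
open import Data.Fin.Subset using (Subset; ∣_∣)
open import Data.Vec using (Vec; []; _∷_; lookup)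
open import Data.List using (List; []; _∷_; map; _++_; foldr; allFin)
open import Data.Integer using (+_)
open import Data.Rational using (ℚ; _/_; 0ℚ; _⊔_)
open import Data.Rational as Q using ()
open import Data.Nat using (_<?_)
open import Relation.Nullary using (yes; no; ¬_)
open import Relation.Binary.PropositionalEquality using (_≡_)

-- Convention: the edge {u,v} with toℕ u < toℕ v is present iff  G u v ≡ true;
-- the values of G u v for toℕ u ≥ toℕ v are ignored everywhere.
Graph : ℕ → Set
Graph n = Fin n → Fin n → Bool

sumFin : (n : ℕ) → (Fin n → ℕ) → ℕ
sumFin n f = foldr _+_ 0 (map f (allFin n))

sumℚ : (k : ℕ) → (Fin k → ℚ) → ℚ
sumℚ k f = foldr Q._+_ 0ℚ (map f (allFin k))

bit : Bool → ℕ
bit true  = 1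
bit false = 0

edgesIn : {n : ℕ} → Graph n → Subset n → ℕ
edgesIn {n} G X = sumFin n λ u → sumFin n λ v →
  bit ((toℕ u <ᵇ toℕ v) ∧ lookup X u ∧ lookup X v ∧ G u v)

-- the density 2 e(G[X]) / |X|  (set to 0 for X = ∅, which never matters
-- since all densities are ≥ 0)
density : {n : ℕ} → Graph n → Subset n → ℚ
density G X with ∣ X ∣
... | zero  = 0ℚ
... | suc m = + (2 * edgesIn G X) / suc m

allSubsets : (n : ℕ) → List (Subset n)
allSubsets zero    = [] ∷ []
allSubsets (suc n) = map (true ∷_) (allSubsets n) ++ map (false ∷_) (allSubsets n)

-- Mad(G) = max over nonempty X ⊆ V(G) of 2 e(G[X]) / |X|
-- (the empty set contributes 0, which is harmless: singletons already give 0)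
Mad : {n : ℕ} → Graph n → ℚ
Mad {n} G = foldr _⊔_ 0ℚ (map (density G) (allSubsets n))

EdgeDisjoint : {n k : ℕ} → (Fin k → Graph n) → Set
EdgeDisjoint {n} {k} G = ∀ (a b : Fin k) → ¬ a ≡ b → ∀ (u v : Fin n) →
  toℕ u < toℕ v → G a u v ≡ true → G b u v ≡ false

sumMad : {n k : ℕ} → (Fin k → Graph n) → ℚ
sumMad {n} {k} G = sumℚ k (λ i → Mad (G i))

-- "m = M(k,n)": m is the maximum of sum Mad over families of k pairwise
-- edge-disjoint subgraphs of K_n (the maximum exists, families are finite).
IsM : (k n : ℕ) → ℚ → Set
IsM k n m =
  (Σ' (Fin k → Graph n) λ G → EdgeDisjoint G × (sumMad G ≡ m))
  × (∀ (G : Fin k → Graph n) → EdgeDisjoint G → sumMad G Q.≤ m)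
  where
  open import Data.Product using (_×_) renaming (Σ to Σ')

-- The graphs H_j from the statement, indexed by j : ℕ (only j < k is used).
-- H_j has vertex set X_j and edge set E(K_n[X_j]) \ ⋃_{i<j} E(H_i).
module Construction {n k : ℕ} (X : Fin k → Subset n) where

  inX : ℕ → Fin n → Bool
  inX j u with j <? k
  ... | yes j<k = lookup (X (fromℕ< j<k)) u
  ... | no  _   = false

  mutual
    covered : ℕ → Fin n → Fin n → Bool
    covered zero    u v = false
    covered (suc j) u v = covered j u v ∨ Hℕ j u v

    Hℕ : ℕ → Graph n
    Hℕ j u v = inX j u ∧ inX j v ∧ not (covered j u v)

  H : Fin k → Graph n
  H j = Hℕ (toℕ j)

{-# OPTIONS --safe #-}
-- Write each density 2e(G[X])/|X| as a sum over pairs uv of a weight 2/|X| per edge of G[X].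
-- An edge uv lies in at most one G_j, and if it lies in G_j[X_j] it is an edge of K_n[X_j],
-- hence of some H_i with i ≤ j, where it weighs 2/|X_i| ≥ 2/|X_j|. Summing over pairs,
--   Σ dens(G_j, X_j) ≤ Σ dens(H_j, X_j) ≤ Σ Mad(H_j) ≤ M(k,n) = Σ Mad(G_j) = Σ dens(G_j, X_j),
-- the last inequality because the H_j are edge-disjoint. So equality holds throughout, and
-- termwise in dens(H_j, X_j) ≤ Mad(H_j).
module Submission where

open import Defs
open import Data.Nat using (ℕ; _≤_; _<_)
open import Data.Fin using (Fin; toℕ)
open import Data.Fin.Subset using (Subset; ∣_∣)
open import Data.Rational using (ℚ)
open import Data.Product using (_×_)
open import Relation.Binary.PropositionalEquality using (_≡_)

open import Data.Bool using (Bool; true; false; _∧_; _∨_; not)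
import Data.Bool.Properties as B
open import Data.Empty using (⊥-elim)
open import Data.Fin using (zero; suc; fromℕ<; punchIn)
import Data.Fin.Properties as FP
open import Data.Integer as ℤ using (+_)
open import Data.Integer.Tactic.RingSolver using (solve-∀)
import Data.Integer.Properties as ℤP
open import Data.List as List using (_∷_; allFin)
import Data.List.Properties as LP
open import Data.List.Membership.Propositional using (_∈_)
open import Data.List.Membership.Propositional.Properties using (∈-++⁺ˡ; ∈-++⁺ʳ; ∈-map⁺)
open import Data.List.Relation.Unary.Any using (here; there)
open import Data.Nat as ℕ using (zero; suc; _+_; _*_; _<ᵇ_)
import Data.Nat.Properties as ℕP
open import Data.Product using (_,_; ∃-syntax)
open import Data.Rational as Q using (0ℚ; _/_; _⊔_)
import Data.Rational.Properties as QP
open import Data.Rational.Unnormalised as U using (mkℚᵘ; *≡*; *≤*)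
import Data.Rational.Unnormalised.Properties as UP
open import Data.Sum using (_⊎_; inj₁; inj₂)
open import Data.Vec using ([]; _∷_; lookup)
import Data.Vec.Functional as Vector
open import Function using (id; _∘_)
open import Function.Bundles using (Equivalence)
open import Relation.Binary using (tri<; tri≈; tri>)
open import Relation.Binary.PropositionalEquality
  using (refl; sym; trans; cong; cong₂; subst; _≢_; module ≡-Reasoning)
open import Relation.Nullary using (yes; no; contradiction)

open import Algebra.Properties.CommutativeMonoid.Sum QP.+-0-commutativeMonoid
  using (sum; sum-syntax; sum-remove; sum-cong-≗; sum-replicate-zero; ∑-comm)
import Algebra.Properties.CommutativeMonoid.Sum ℕP.+-0-commutativeMonoid as ℕ-Sum

foldr-tabulate : ∀ {A : Set} (_∙_ : A → A → A) (ε : A) {n} (f : Fin n → A) →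
  List.foldr _∙_ ε (List.tabulate f) ≡ Vector.foldr _∙_ ε f
foldr-tabulate _∙_ ε {zero}  f = refl
foldr-tabulate _∙_ ε {suc n} f = cong (f zero ∙_) (foldr-tabulate _∙_ ε (f ∘ suc))

foldr-map-allFin : ∀ {A : Set} (_∙_ : A → A → A) (ε : A) n (f : Fin n → A) →
  List.foldr _∙_ ε (List.map f (allFin n)) ≡ Vector.foldr _∙_ ε f
foldr-map-allFin _∙_ ε n f =
  trans (cong (List.foldr _∙_ ε) (LP.map-tabulate id f)) (foldr-tabulate _∙_ ε f)

sumFin≡sum : ∀ n (f : Fin n → ℕ) → sumFin n f ≡ ℕ-Sum.sum f
sumFin≡sum = foldr-map-allFin _+_ 0

sumMad≡sum : ∀ {n k} (F : Fin k → Graph n) → sumMad F ≡ ∑[ j < k ] Mad (F j)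
sumMad≡sum {k = k} F = foldr-map-allFin Q._+_ 0ℚ k (Mad ∘ F)

sum-mono-≤ : ∀ {n} {f g : Fin n → ℚ} → (∀ i → f i Q.≤ g i) → sum f Q.≤ sum g
sum-mono-≤ {zero}  f≤g = QP.≤-refl
sum-mono-≤ {suc n} f≤g = QP.+-mono-≤ (f≤g zero) (sum-mono-≤ (f≤g ∘ suc))

sum-mono-< : ∀ {n} {f g : Fin n → ℚ} → (∀ i → f i Q.≤ g i) → ∀ i → f i Q.< g i → sum f Q.< sum g
sum-mono-< {suc n} f≤g zero    f₀<g₀ = QP.+-mono-<-≤ f₀<g₀ (sum-mono-≤ (f≤g ∘ suc))
sum-mono-< {suc n} f≤g (suc i) fᵢ<gᵢ = QP.+-mono-≤-< (f≤g zero) (sum-mono-< (f≤g ∘ suc) i fᵢ<gᵢ)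

sum-nonNeg : ∀ {n} {f : Fin n → ℚ} → (∀ i → 0ℚ Q.≤ f i) → 0ℚ Q.≤ sum f
sum-nonNeg {n} f≥0 = QP.≤-trans (QP.≤-reflexive (sym (sum-replicate-zero n))) (sum-mono-≤ f≥0)

term≤sum : ∀ {n} {f : Fin n → ℚ} → (∀ i → 0ℚ Q.≤ f i) → ∀ i → f i Q.≤ sum f
term≤sum {suc n} {f} f≥0 zero = begin
  f zero                    ≡⟨ QP.+-identityʳ (f zero) ⟨
  f zero Q.+ 0ℚ             ≤⟨ QP.+-monoʳ-≤ (f zero) (sum-nonNeg (f≥0 ∘ suc)) ⟩
  f zero Q.+ sum (f ∘ suc)  ∎
  where open QP.≤-Reasoning
term≤sum {suc n} {f} f≥0 (suc i) = begin
  f (suc i)                 ≡⟨ QP.+-identityˡ (f (suc i)) ⟨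
  0ℚ Q.+ f (suc i)          ≤⟨ QP.+-mono-≤ (f≥0 zero) (term≤sum (f≥0 ∘ suc) i) ⟩
  f zero Q.+ sum (f ∘ suc)  ∎
  where open QP.≤-Reasoning

sum-single : ∀ {n} (f : Fin n → ℚ) i → (∀ j → j ≢ i → f j ≡ 0ℚ) → sum f ≡ f i
sum-single {suc n} f i others = begin
  sum f                             ≡⟨ sum-remove f ⟩
  f i Q.+ sum (f ∘ punchIn i)       ≡⟨ cong (f i Q.+_) (sum-cong-≗ (λ j → others _ (FP.punchInᵢ≢i i j))) ⟩
  f i Q.+ sum (λ (_ : Fin n) → 0ℚ)  ≡⟨ cong (f i Q.+_) (sum-replicate-zero n) ⟩
  f i Q.+ 0ℚ                        ≡⟨ QP.+-identityʳ (f i) ⟩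
  f i                               ∎
  where open ≡-Reasoning

pointwise-≤∧sum-≥⇒≗ : ∀ {n} {f g : Fin n → ℚ} →
  (∀ i → f i Q.≤ g i) → sum g Q.≤ sum f → ∀ i → f i ≡ g i
pointwise-≤∧sum-≥⇒≗ f≤g Σg≤Σf i = QP.≤-antisym (f≤g i)
  (QP.≮⇒≥ λ fᵢ<gᵢ → QP.<-irrefl refl (QP.<-≤-trans (sum-mono-< f≤g i fᵢ<gᵢ) Σg≤Σf))

-- a /ℕ 0 = 0, the junk value density also takes on X = ∅.
infixl 7 _/ℕ_
_/ℕ_ : ℕ → ℕ → ℚ
a /ℕ zero  = 0ℚ
a /ℕ suc m = + a / suc m

0/ℕ : ∀ s → 0 /ℕ s ≡ 0ℚ
0/ℕ zero    = refl
0/ℕ (suc m) = QP.0/n≡0 (suc m)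

/ℕ-nonNeg : ∀ a s → 0ℚ Q.≤ a /ℕ s
/ℕ-nonNeg a zero    = QP.≤-refl
/ℕ-nonNeg a (suc m) = QP.nonNegative⁻¹ _ {{QP.normalize-nonNeg a (suc m)}}

/ℕ-distribʳ-+ : ∀ a b s → (a + b) /ℕ s ≡ a /ℕ s Q.+ b /ℕ s
/ℕ-distribʳ-+ a b zero    = sym (QP.+-identityˡ 0ℚ)
/ℕ-distribʳ-+ a b (suc m) = QP.toℚᵘ-injective (begin
  Q.toℚᵘ ((a + b) /ℕ suc m)
    ≈⟨ QP.toℚᵘ-fromℚᵘ (mkℚᵘ (+ (a + b)) m) ⟩
  mkℚᵘ (+ (a + b)) m
    ≈⟨ *≡* cross-multiplied ⟩
  mkℚᵘ (+ a) m U.+ mkℚᵘ (+ b) m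
    ≈⟨ UP.+-cong (UP.≃-sym (QP.toℚᵘ-fromℚᵘ (mkℚᵘ (+ a) m)))
                 (UP.≃-sym (QP.toℚᵘ-fromℚᵘ (mkℚᵘ (+ b) m))) ⟩
  Q.toℚᵘ (a /ℕ suc m) U.+ Q.toℚᵘ (b /ℕ suc m)
    ≈⟨ UP.≃-sym (QP.toℚᵘ-homo-+ (a /ℕ suc m) (b /ℕ suc m)) ⟩
  Q.toℚᵘ (a /ℕ suc m Q.+ b /ℕ suc m)
    ∎)
  where
  open UP.≃-Reasoning
  same-denominator : ∀ (x y s : ℤ.ℤ) → (x ℤ.+ y) ℤ.* (s ℤ.* s) ≡ (x ℤ.* s ℤ.+ y ℤ.* s) ℤ.* s
  same-denominator = solve-∀
  cross-multiplied :
    + (a + b) ℤ.* + (suc m * suc m) ≡ (+ a ℤ.* + suc m ℤ.+ + b ℤ.* + suc m) ℤ.* + suc m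
  cross-multiplied = trans (cong (+ (a + b) ℤ.*_) (ℤP.pos-* (suc m) (suc m)))
                           (same-denominator (+ a) (+ b) (+ suc m))

/ℕ-antimonoʳ-≤ : ∀ c {a b} → 0 < a → a ≤ b → c /ℕ b Q.≤ c /ℕ a
/ℕ-antimonoʳ-≤ c {suc a} {suc b} _ a≤b = QP.toℚᵘ-cancel-≤
  (UP.≤-respˡ-≃ (UP.≃-sym (QP.toℚᵘ-fromℚᵘ (mkℚᵘ (+ c) b)))
  (UP.≤-respʳ-≃ (UP.≃-sym (QP.toℚᵘ-fromℚᵘ (mkℚᵘ (+ c) a)))
  (*≤* (ℤP.*-monoˡ-≤-nonNeg (+ c) (ℤ.+≤+ a≤b)))))

*-sum-/ℕ : ∀ c s {n} (f : Fin n → ℕ) → (c * ℕ-Sum.sum f) /ℕ s ≡ ∑[ i < n ] ((c * f i) /ℕ s)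
*-sum-/ℕ c s {zero}  f = trans (cong (_/ℕ s) (ℕP.*-zeroʳ c)) (0/ℕ s)
*-sum-/ℕ c s {suc n} f = begin
  (c * (f zero + ℕ-Sum.sum (f ∘ suc))) /ℕ s
    ≡⟨ cong (_/ℕ s) (ℕP.*-distribˡ-+ c (f zero) _) ⟩
  (c * f zero + c * ℕ-Sum.sum (f ∘ suc)) /ℕ s
    ≡⟨ /ℕ-distribʳ-+ (c * f zero) _ s ⟩
  (c * f zero) /ℕ s Q.+ (c * ℕ-Sum.sum (f ∘ suc)) /ℕ s
    ≡⟨ cong ((c * f zero) /ℕ s Q.+_) (*-sum-/ℕ c s (f ∘ suc)) ⟩
  ∑[ i < suc n ] ((c * f i) /ℕ s)
    ∎
  where open ≡-Reasoning

inducedEdge : ∀ {n} → Graph n → Subset n → Fin n → Fin n → Bool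
inducedEdge G X u v = (toℕ u <ᵇ toℕ v) ∧ lookup X u ∧ lookup X v ∧ G u v

edgeWeight : ∀ {n} → Graph n → Subset n → Fin n → Fin n → ℚ
edgeWeight G X u v = (2 * bit (inducedEdge G X u v)) /ℕ ∣ X ∣

density≡/ℕ : ∀ {n} (G : Graph n) X → density G X ≡ (2 * edgesIn G X) /ℕ ∣ X ∣
density≡/ℕ G X with ∣ X ∣
... | zero  = refl
... | suc m = refl

density≡sum-edgeWeight : ∀ {n} (G : Graph n) X →
  density G X ≡ ∑[ u < n ] ∑[ v < n ] edgeWeight G X u v
density≡sum-edgeWeight {n} G X = begin
  density G X                                           ≡⟨ density≡/ℕ G X ⟩
  (2 * sumFin n (λ u → sumFin n (bitAt u))) /ℕ ∣ X ∣    ≡⟨ cong (λ e → (2 * e) /ℕ ∣ X ∣) edgesIn≡ ⟩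
  (2 * ℕ-Sum.sum (λ u → ℕ-Sum.sum (bitAt u))) /ℕ ∣ X ∣  ≡⟨ *-sum-/ℕ 2 ∣ X ∣ (ℕ-Sum.sum ∘ bitAt) ⟩
  ∑[ u < n ] ((2 * ℕ-Sum.sum (bitAt u)) /ℕ ∣ X ∣)       ≡⟨ sum-cong-≗ (λ u → *-sum-/ℕ 2 ∣ X ∣ (bitAt u)) ⟩
  ∑[ u < n ] ∑[ v < n ] edgeWeight G X u v              ∎
  where
  open ≡-Reasoning
  bitAt : Fin n → Fin n → ℕ
  bitAt u v = bit (inducedEdge G X u v)
  edgesIn≡ : sumFin n (λ u → sumFin n (bitAt u)) ≡ ℕ-Sum.sum (λ u → ℕ-Sum.sum (bitAt u))
  edgesIn≡ = trans (sumFin≡sum n _) (ℕ-Sum.sum-cong-≗ (λ u → sumFin≡sum n (bitAt u)))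

∈-allSubsets : ∀ n (X : Subset n) → X ∈ allSubsets n
∈-allSubsets zero    []          = here refl
∈-allSubsets (suc n) (true ∷ X)  = ∈-++⁺ˡ (∈-map⁺ (true ∷_) (∈-allSubsets n X))
∈-allSubsets (suc n) (false ∷ X) = ∈-++⁺ʳ _ (∈-map⁺ (false ∷_) (∈-allSubsets n X))

∈⇒≤foldr-⊔ : ∀ {p : ℚ} {ps} z → p ∈ ps → p Q.≤ List.foldr _⊔_ z ps
∈⇒≤foldr-⊔ z (here refl) = QP.p≤p⊔q _ _
∈⇒≤foldr-⊔ {ps = q ∷ _} z (there p∈ps) = QP.≤-trans (∈⇒≤foldr-⊔ z p∈ps) (QP.p≤q⊔p q _)

density≤Mad : ∀ {n} (G : Graph n) X → density G X Q.≤ Mad G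
density≤Mad {n} G X = ∈⇒≤foldr-⊔ 0ℚ (∈-map⁺ (density G) (∈-allSubsets n X))

sum-density≡sum-edgeWeight : ∀ {n k} (F : Fin k → Graph n) (X : Fin k → Subset n) →
  ∑[ j < k ] density (F j) (X j) ≡ ∑[ u < n ] ∑[ v < n ] ∑[ j < k ] edgeWeight (F j) (X j) u v
sum-density≡sum-edgeWeight {n} {k} F X = begin
  ∑[ j < k ] density (F j) (X j)                 ≡⟨ sum-cong-≗ (λ j → density≡sum-edgeWeight (F j) (X j)) ⟩
  ∑[ j < k ] ∑[ u < n ] ∑[ v < n ] weight j u v  ≡⟨ ∑-comm (λ j u → ∑[ v < n ] weight j u v) ⟩
  ∑[ u < n ] ∑[ j < k ] ∑[ v < n ] weight j u v  ≡⟨ sum-cong-≗ (λ u → ∑-comm (λ j v → weight j u v)) ⟩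
  ∑[ u < n ] ∑[ v < n ] ∑[ j < k ] weight j u v  ∎
  where
  open ≡-Reasoning
  weight : Fin k → Fin n → Fin n → ℚ
  weight j = edgeWeight (F j) (X j)

∧-≡-true : ∀ {x y} → x ∧ y ≡ true → x ≡ true × y ≡ true
∧-≡-true {true} {true} refl = refl , refl

∨-≡-true : ∀ x {y} → x ∨ y ≡ true → x ≡ true ⊎ y ≡ true
∨-≡-true true  _ = inj₁ refl
∨-≡-true false e = inj₂ e

module _ {n} (G : Graph n) (X : Subset n) (u v : Fin n) where

  inducedEdge⇒ : inducedEdge G X u v ≡ true →
    toℕ u < toℕ v × lookup X u ≡ true × lookup X v ≡ true × G u v ≡ true
  inducedEdge⇒ e =
    let u<ᵇv , e′ = ∧-≡-true e
        Xu , e″ = ∧-≡-true e′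
        Xv , Guv = ∧-≡-true e″
    in ℕP.<ᵇ⇒< (toℕ u) (toℕ v) (Equivalence.from B.T-≡ u<ᵇv) , Xu , Xv , Guv

  inducedEdge⇐ : toℕ u < toℕ v → lookup X u ≡ true → lookup X v ≡ true → G u v ≡ true →
    inducedEdge G X u v ≡ true
  inducedEdge⇐ u<v Xu Xv Guv = begin
    (toℕ u <ᵇ toℕ v) ∧ lookup X u ∧ lookup X v ∧ G u v
      ≡⟨ cong₂ (λ x y → (toℕ u <ᵇ toℕ v) ∧ x ∧ y ∧ G u v) Xu Xv ⟩
    (toℕ u <ᵇ toℕ v) ∧ G u v                            ≡⟨ cong ((toℕ u <ᵇ toℕ v) ∧_) Guv ⟩
    (toℕ u <ᵇ toℕ v) ∧ true                             ≡⟨ B.∧-identityʳ _ ⟩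
    toℕ u <ᵇ toℕ v                                      ≡⟨ Equivalence.to B.T-≡ (ℕP.<⇒<ᵇ u<v) ⟩
    true                                                ∎
    where open ≡-Reasoning

  inducedEdge-nonEdge : G u v ≡ false → inducedEdge G X u v ≡ false
  inducedEdge-nonEdge Guv rewrite Guv | B.∧-zeroʳ (lookup X v) | B.∧-zeroʳ (lookup X u) =
    B.∧-zeroʳ (toℕ u <ᵇ toℕ v)

  edgeWeight-true : inducedEdge G X u v ≡ true → edgeWeight G X u v ≡ 2 /ℕ ∣ X ∣
  edgeWeight-true e = cong (λ b → (2 * bit b) /ℕ ∣ X ∣) e

  edgeWeight-false : inducedEdge G X u v ≡ false → edgeWeight G X u v ≡ 0ℚ
  edgeWeight-false e = trans (cong (λ b → (2 * bit b) /ℕ ∣ X ∣) e) (0/ℕ ∣ X ∣)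

module _ {n k : ℕ} (X : Fin k → Subset n) where
  open Construction X

  inX-toℕ : ∀ j u → inX (toℕ j) u ≡ lookup (X j) u
  inX-toℕ j u with toℕ j ℕ.<? k
  ... | yes j<k = cong (λ i → lookup (X i) u) (FP.fromℕ<-toℕ j j<k)
  ... | no  j≮k = ⊥-elim (j≮k (FP.toℕ<n j))

  Hℕ⇒covered : ∀ {i j u v} → Hℕ i u v ≡ true → i < j → covered j u v ≡ true
  Hℕ⇒covered {i} {suc j} {u} {v} Hᵢuv (ℕ.s≤s i≤j) with ℕP.m≤n⇒m<n∨m≡n i≤j
  ... | inj₁ i<j  = cong (_∨ Hℕ j u v) (Hℕ⇒covered Hᵢuv i<j)
  ... | inj₂ refl = trans (cong (covered i u v ∨_) Hᵢuv) (B.∨-zeroʳ _)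

  covered⇒Hℕ : ∀ {j u v} → covered j u v ≡ true → ∃[ i ] i < j × Hℕ i u v ≡ true
  covered⇒Hℕ {suc j} {u} {v} c with ∨-≡-true (covered j u v) c
  ... | inj₁ cⱼ  = let i , i<j , Hᵢuv = covered⇒Hℕ cⱼ in i , ℕP.m<n⇒m<1+n i<j , Hᵢuv
  ... | inj₂ Hⱼuv = j , ℕP.n<1+n j , Hⱼuv

  covered-suc : ∀ {j u v} → inX j u ≡ true → inX j v ≡ true → covered (suc j) u v ≡ true
  covered-suc {j} {u} {v} Xu Xv = begin
    covered j u v ∨ (inX j u ∧ inX j v ∧ not (covered j u v))
      ≡⟨ cong₂ (λ x y → covered j u v ∨ (x ∧ y ∧ not (covered j u v))) Xu Xv ⟩
    covered j u v ∨ not (covered j u v)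
      ≡⟨ B.∨-inverseʳ (covered j u v) ⟩
    true ∎
    where open ≡-Reasoning

  Hℕ-disjoint : ∀ {i j u v} → Hℕ i u v ≡ true → i < j → Hℕ j u v ≡ false
  Hℕ-disjoint {i} {j} {u} {v} Hᵢuv i<j = begin
    inX j u ∧ inX j v ∧ not (covered j u v)  ≡⟨ cong (λ c → inX j u ∧ inX j v ∧ not c) (Hℕ⇒covered Hᵢuv i<j) ⟩
    inX j u ∧ inX j v ∧ false                ≡⟨ cong (inX j u ∧_) (B.∧-zeroʳ (inX j v)) ⟩
    inX j u ∧ false                          ≡⟨ B.∧-zeroʳ (inX j u) ⟩
    false                                    ∎
    where open ≡-Reasoning

  H-edgeDisjoint : EdgeDisjoint H
  H-edgeDisjoint a b a≢b u v _ Hₐuv with ℕP.<-cmp (toℕ a) (toℕ b)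
  ... | tri< a<b _ _ = Hℕ-disjoint Hₐuv a<b
  ... | tri≈ _ a≡b _ = ⊥-elim (a≢b (FP.toℕ-injective a≡b))
  ... | tri> _ _ b<a = B.¬-not λ Hᵦuv →
    contradiction (trans (sym Hₐuv) (Hℕ-disjoint Hᵦuv b<a)) λ ()

  H⊆K[X] : ∀ {i u v} → H i u v ≡ true → lookup (X i) u ≡ true × lookup (X i) v ≡ true
  H⊆K[X] {i} {u} {v} Hᵢuv =
    let Xu , e = ∧-≡-true Hᵢuv
        Xv , _ = ∧-≡-true e
    in trans (sym (inX-toℕ i u)) Xu , trans (sym (inX-toℕ i v)) Xv

  K[X]⊆⋃H : ∀ {j u v} → lookup (X j) u ≡ true → lookup (X j) v ≡ true →
    ∃[ i ] toℕ i ≤ toℕ j × H i u v ≡ true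
  K[X]⊆⋃H {j} {u} {v} Xu Xv
    with covered⇒Hℕ (covered-suc (trans (inX-toℕ j u) Xu) (trans (inX-toℕ j v) Xv))
  ... | i , i<1+j , Hᵢuv = fromℕ< i<k , subst (_≤ toℕ j) (sym toℕ[i]≡i) i≤j
                         , subst (λ i → Hℕ i u v ≡ true) (sym toℕ[i]≡i) Hᵢuv
    where
    i≤j = ℕP.m<1+n⇒m≤n i<1+j
    i<k = ℕP.≤-<-trans i≤j (FP.toℕ<n j)
    toℕ[i]≡i = FP.toℕ-fromℕ< i<k

module _ {n k : ℕ} {G : Fin k → Graph n} (G-disjoint : EdgeDisjoint G) (X : Fin k → Subset n)
         (X-nonempty : ∀ j → 0 < ∣ X j ∣) (X-sorted : ∀ a b → toℕ a ≤ toℕ b → ∣ X a ∣ ≤ ∣ X b ∣) where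
  open Construction X using (H)

  sum-edgeWeight-≤ : ∀ u v →
    ∑[ j < k ] edgeWeight (G j) (X j) u v Q.≤ ∑[ j < k ] edgeWeight (H j) (X j) u v
  sum-edgeWeight-≤ u v with FP.any? (λ j → inducedEdge (G j) (X j) u v B.≟ true)
  ... | no ∄j = begin
    ∑[ j < k ] edgeWeight (G j) (X j) u v
      ≡⟨ sum-cong-≗ (λ j → edgeWeight-false (G j) (X j) u v (B.¬-not (∄j ∘ (j ,_)))) ⟩
    ∑[ j < k ] 0ℚ                          ≡⟨ sum-replicate-zero k ⟩
    0ℚ                                     ≤⟨ sum-nonNeg (λ j → /ℕ-nonNeg _ ∣ X j ∣) ⟩
    ∑[ j < k ] edgeWeight (H j) (X j) u v  ∎
    where open QP.≤-Reasoning
  ... | yes (j , Gⱼ[Xⱼ]uv) =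
    let u<v , Xⱼu , Xⱼv , Gⱼuv = inducedEdge⇒ (G j) (X j) u v Gⱼ[Xⱼ]uv
        i , i≤j , Hᵢuv = K[X]⊆⋃H X Xⱼu Xⱼv
        Xᵢu , Xᵢv = H⊆K[X] X Hᵢuv
        H[X]ᵢuv = inducedEdge⇐ (H i) (X i) u v u<v Xᵢu Xᵢv Hᵢuv
        only-j : ∀ j′ → j′ ≢ j → edgeWeight (G j′) (X j′) u v ≡ 0ℚ
        only-j j′ j′≢j = edgeWeight-false (G j′) (X j′) u v
          (inducedEdge-nonEdge (G j′) (X j′) u v (G-disjoint j j′ (j′≢j ∘ sym) u v u<v Gⱼuv))
    in begin
    ∑[ j < k ] edgeWeight (G j) (X j) u v  ≡⟨ sum-single _ j only-j ⟩
    edgeWeight (G j) (X j) u v             ≡⟨ edgeWeight-true (G j) (X j) u v Gⱼ[Xⱼ]uv ⟩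
    2 /ℕ ∣ X j ∣                           ≤⟨ /ℕ-antimonoʳ-≤ 2 (X-nonempty i) (X-sorted i j i≤j) ⟩
    2 /ℕ ∣ X i ∣                           ≡⟨ edgeWeight-true (H i) (X i) u v H[X]ᵢuv ⟨
    edgeWeight (H i) (X i) u v             ≤⟨ term≤sum (λ j → /ℕ-nonNeg _ ∣ X j ∣) i ⟩
    ∑[ j < k ] edgeWeight (H j) (X j) u v  ∎
    where open QP.≤-Reasoning

  sum-density-≤ : ∑[ j < k ] density (G j) (X j) Q.≤ ∑[ j < k ] density (H j) (X j)
  sum-density-≤ = begin
    ∑[ j < k ] density (G j) (X j)                          ≡⟨ sum-density≡sum-edgeWeight G X ⟩
    ∑[ u < n ] ∑[ v < n ] ∑[ j < k ] edgeWeight (G j) (X j) u v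
      ≤⟨ sum-mono-≤ (λ u → sum-mono-≤ (sum-edgeWeight-≤ u)) ⟩
    ∑[ u < n ] ∑[ v < n ] ∑[ j < k ] edgeWeight (H j) (X j) u v ≡⟨ sum-density≡sum-edgeWeight H X ⟨
    ∑[ j < k ] density (H j) (X j)                          ∎
    where open QP.≤-Reasoning

proposition3p4 : (n k : ℕ) → 3 ≤ n → 2 ≤ k →
    (G : Fin k → Graph n) → EdgeDisjoint G →
    (m : ℚ) → IsM k n m → sumMad G ≡ m →
    (X : Fin k → Subset n) →
    (∀ j → 0 < ∣ X j ∣) →
    (∀ j → density (G j) (X j) ≡ Mad (G j)) →
    (∀ (a b : Fin k) → toℕ a ≤ toℕ b → ∣ X a ∣ ≤ ∣ X b ∣) →
    (sumMad (Construction.H X) ≡ m)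
    × (∀ j → Mad (Construction.H X j) ≡ density (Construction.H X j) (X j))
proposition3p4 n k _ _ G G-disjoint m (_ , m-maximal) ΣMadG≡m X X-nonempty G-dense X-sorted =
  QP.≤-antisym (m-maximal H (H-edgeDisjoint X)) (QP.≤-trans m≤ΣdensH ΣdensH≤ΣMadH)
  , λ j → sym (pointwise-≤∧sum-≥⇒≗ densH≤MadH (QP.≤-trans ΣMadH≤m m≤ΣdensH) j)
  where
  open Construction X using (H)
  densH≤MadH : ∀ j → density (H j) (X j) Q.≤ Mad (H j)
  densH≤MadH j = density≤Mad (H j) (X j)
  ΣMadH≤m : ∑[ j < k ] Mad (H j) Q.≤ m
  ΣMadH≤m = QP.≤-trans (QP.≤-reflexive (sym (sumMad≡sum H))) (m-maximal H (H-edgeDisjoint X))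
  ΣdensH≤ΣMadH : ∑[ j < k ] density (H j) (X j) Q.≤ sumMad H
  ΣdensH≤ΣMadH = QP.≤-trans (sum-mono-≤ densH≤MadH) (QP.≤-reflexive (sym (sumMad≡sum H)))
  m≤ΣdensH : m Q.≤ ∑[ j < k ] density (H j) (X j)
  m≤ΣdensH = begin
    m                               ≡⟨ ΣMadG≡m ⟨
    sumMad G                        ≡⟨ sumMad≡sum G ⟩
    ∑[ j < k ] Mad (G j)            ≡⟨ sum-cong-≗ G-dense ⟨
    ∑[ j < k ] density (G j) (X j)  ≤⟨ sum-density-≤ G-disjoint X X-nonempty X-sorted ⟩
    ∑[ j < k ] density (H j) (X j)  ∎
    where open QP.≤-Reasoning
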